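{- For every integer $k\geq 3$, the graph $F_k = K_2\times K_k$ is bipartite and has a unique fall $k$-coloring (up to renaming the color classes).
   Context: $G\times H$ denotes the categorical (tensor) product: vertex set $V(G)\times V(H)$, with $(u_1,v_1)(u_2,v_2)$ an edge iff $u_1u_2\in E(G)$ and $v_1v_2\in E(H)$. For a graph $G=(V,E)$ and a partition $\Pi=\{V_1,\dots,V_k\}$ of $V$, a vertex $v\in V_i$ is colorful if $v$ is adjacent to at least one vertex of each class $V_j$ with $j\neq i$; $\Pi$ is a fall $k$-coloring if every $V_i$ is independent and every vertex is colorful. -}

module Defs where

open import Level using (0ℓ)
open import Data.Nat using (ℕ)
open import Data.Fin using (Fin)
open import Data.Product using (Σ; ∃; _×_; _,_; proj₁; proj₂)
open import Relation.Binary.PropositionalEquality using (_≡_; _≢_)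
open import Function.Bundles using (_↔_; Inverse)

record Graph : Set₁ where
  field
    V   : Set
    Adj : V → V → Set
open Graph public

K : ℕ → Graph
K n = record { V = Fin n ; Adj = λ i j → i ≢ j }

_⊗_ : Graph → Graph → Graph
G ⊗ H = record
  { V   = V G × V H
  ; Adj = λ p q → Adj G (proj₁ p) (proj₁ q) × Adj H (proj₂ p) (proj₂ q) }

F : ℕ → Graph
F k = K 2 ⊗ K k

Bipartite : Graph → Set
Bipartite G = Σ (V G → Fin 2) λ f → ∀ u v → Adj G u v → f u ≢ f v

-- A partition of V G into k (nonempty) classes V_0,…,V_{k-1}, encoded by
-- the class-index map c : V G → Fin k (surjective, so each class is nonempty).
record IsFallColoring (G : Graph) (k : ℕ) (c : V G → Fin k) : Set where
  field
    nonempty    : ∀ (i : Fin k) → ∃ λ v → c v ≡ i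
    independent : ∀ u v → Adj G u v → c u ≢ c v
    colorful    : ∀ v (j : Fin k) → j ≢ c v → ∃ λ u → Adj G v u × c u ≡ j

UniqueFallColoring : Graph → ℕ → Set
UniqueFallColoring G k =
  Σ (V G → Fin k) λ c → IsFallColoring G k c ×
    (∀ (c′ : V G → Fin k) → IsFallColoring G k c′ →
       Σ (Fin k ↔ Fin k) λ π → ∀ v → c′ v ≡ Inverse.to π (c v))

module Submission where

-- F_k = K₂ × K_k has vertices (a , i) with a a side of K₂ and i a column of
-- K_k, and (a , i) ~ (b , j) exactly when a ≢ b and i ≢ j.  So the side
-- index is a proper 2-colouring (F_k is bipartite) and the column index is a
-- fall k-colouring: (a , i) sees every other column j at (opp a , j).
--
-- Let c be any fall k-colouring.  The vertex (opp b , i) has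
-- the k-1 neighbours (b , j), j ≢ i, which must show all k-1 colours other
-- than its own; hence the map "column j ↦ colour of (b , j), except column
-- i ↦ colour of (opp b , i)" is onto, so injective (a finite fact about
-- endomaps of Fin k).  For k ≥ 3 any two columns j ≢ j' avoid some third
-- column i, so each row c (b , _) is injective, hence a bijection.  Finally
-- c (b , i) must equal c (opp b , i): it equals c (opp b , j) for some j, and
-- j ≢ i is impossible because (b , i) ~ (opp b , j).  Thus c is the column
-- colouring relabelled by the bijection c (0 , _).

open import Defs
open import Data.Nat using (ℕ; suc; _≤_; s≤s)
open import Data.Nat.Properties using (<-irrefl)
open import Data.Product using (_×_; _,_; proj₁; proj₂; ∃; Σ)
open import Data.Fin using (Fin; punchOut) renaming (zero to fz; suc to fs)
open import Data.Fin.Properties using (any?; _≟_; punchOut-injective; injective⇒≤)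
open import Data.Empty using (⊥-elim)
open import Relation.Nullary using (yes; no)
open import Relation.Binary.PropositionalEquality
open import Function.Definitions using (Injective)
open import Function.Bundles using (_↔_; Inverse; mk↔ₛ′)

Onto : {A B : Set} → (A → B) → Set
Onto f = ∀ y → ∃ λ x → f x ≡ y

-- An injective endomap of a finite set is onto: a missed point z lets us
-- squeeze Fin (suc n) injectively into Fin n by punching z out.
injective⇒onto : ∀ {n} (f : Fin n → Fin n) → Injective _≡_ _≡_ f → Onto f
injective⇒onto {suc n} f f-inj z with any? (λ x → f x ≟ z)
... | yes hit = hit
... | no  miss = ⊥-elim (<-irrefl refl (injective⇒≤ squeeze-injective))
  where
  z≢f : ∀ x → z ≢ f x
  z≢f x z≡fx = miss (x , sym z≡fx)

  squeeze-injective : Injective _≡_ _≡_ (λ x → punchOut (z≢f x))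
  squeeze-injective eq = f-inj (punchOut-injective (z≢f _) (z≢f _) eq)

-- Conversely an onto endomap of a finite set is injective: a chosen section
-- is injective, hence onto, so it is also a left inverse of f.
onto⇒injective : ∀ {n} (f : Fin n → Fin n) → Onto f → Injective _≡_ _≡_ f
onto⇒injective {n} f f-onto {x} {y} fx≡fy = begin
  x                ≡⟨ section-retracts x ⟨
  section (f x)    ≡⟨ cong section fx≡fy ⟩
  section (f y)    ≡⟨ section-retracts y ⟩
  y                ∎
  where
  open ≡-Reasoning

  section : Fin n → Fin n
  section z = proj₁ (f-onto z)

  f∘section : ∀ z → f (section z) ≡ z
  f∘section z = proj₂ (f-onto z)

  section-injective : Injective _≡_ _≡_ section
  section-injective {z} {z'} eq =
    trans (sym (f∘section z)) (trans (cong f eq) (f∘section z'))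

  section-retracts : ∀ w → section (f w) ≡ w
  section-retracts w with injective⇒onto section section-injective w
  ... | z , refl = cong section (f∘section z)

injective⇒permutation : ∀ {n} (f : Fin n → Fin n) → Injective _≡_ _≡_ f → Fin n ↔ Fin n
injective⇒permutation {n} f f-inj =
  mk↔ₛ′ f preimage (λ y → proj₂ (onto y)) (λ x → f-inj (proj₂ (onto (f x))))
  where
  onto : Onto f
  onto = injective⇒onto f f-inj

  preimage : Fin n → Fin n
  preimage y = proj₁ (onto y)

avoid-two : ∀ {m} (j j' : Fin (suc (suc (suc m)))) → ∃ λ i → i ≢ j × i ≢ j'
avoid-two fz          fz          = fs fz      , (λ ()) , (λ ())
avoid-two fz          (fs fz)     = fs (fs fz) , (λ ()) , (λ ())
avoid-two fz          (fs (fs _)) = fs fz      , (λ ()) , (λ ())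
avoid-two (fs fz)     fz          = fs (fs fz) , (λ ()) , (λ ())
avoid-two (fs fz)     (fs _)      = fz         , (λ ()) , (λ ())
avoid-two (fs (fs _)) fz          = fs fz      , (λ ()) , (λ ())
avoid-two (fs (fs _)) (fs _)      = fz         , (λ ()) , (λ ())

opp : Fin 2 → Fin 2
opp fz     = fs fz
opp (fs _) = fz

opp-≢ : ∀ a → a ≢ opp a
opp-≢ fz      ()
opp-≢ (fs fz) ()

opp-≢⇒≡ : ∀ {a b : Fin 2} → opp a ≢ b → b ≡ a
opp-≢⇒≡ {fz}    {fz}    _     = refl
opp-≢⇒≡ {fz}    {fs fz} opp≢b = ⊥-elim (opp≢b refl)
opp-≢⇒≡ {fs fz} {fz}    opp≢b = ⊥-elim (opp≢b refl)
opp-≢⇒≡ {fs fz} {fs fz} _     = refl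

F-bipartite : ∀ k → Bipartite (F k)
F-bipartite k = proj₁ , λ u v u~v → proj₁ u~v

columns-isFall : ∀ k → IsFallColoring (F k) k proj₂
columns-isFall k = record
  { nonempty    = λ i → (fz , i) , refl
  ; independent = λ u v u~v → proj₂ u~v
  ; colorful    = λ { (a , i) j j≢i → (opp a , j) , (opp-≢ a , ≢-sym j≢i) , refl }
  }

module FallColoring {k : ℕ} (c : V (F k) → Fin k) (fall : IsFallColoring (F k) k c) where
  open IsFallColoring fall

  -- The colours seen from (opp b , i), read column by column along row b,
  -- with the vertex's own colour placed in its own column i.
  closedRow : Fin 2 → Fin k → Fin k → Fin k
  closedRow b i j with j ≟ i
  ... | yes _ = c (opp b , i)
  ... | no  _ = c (b , j)

  closedRow-off : ∀ b i j → j ≢ i → closedRow b i j ≡ c (b , j)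
  closedRow-off b i j j≢i with j ≟ i
  ... | yes j≡i = ⊥-elim (j≢i j≡i)
  ... | no  _   = refl

  closedRow-on : ∀ b i → closedRow b i i ≡ c (opp b , i)
  closedRow-on b i with i ≟ i
  ... | yes _   = refl
  ... | no  i≢i = ⊥-elim (i≢i refl)

  -- Colourfulness of (opp b , i) says exactly that closedRow b i is onto.
  closedRow-onto : ∀ b i → Onto (closedRow b i)
  closedRow-onto b i y with y ≟ c (opp b , i)
  ... | yes y≡own = i , trans (closedRow-on b i) (sym y≡own)
  ... | no  y≢own with colorful (opp b , i) y y≢own
  ... | (b' , j) , (opp≢b' , i≢j) , cb'j≡y =
    j , trans (closedRow-off b i j (≢-sym i≢j))
              (subst (λ a → c (a , j) ≡ y) (opp-≢⇒≡ opp≢b') cb'j≡y)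

  row-injective-off : ∀ b i {j j'} → j ≢ i → j' ≢ i → c (b , j) ≡ c (b , j') → j ≡ j'
  row-injective-off b i {j} {j'} j≢i j'≢i cbj≡cbj' =
    onto⇒injective (closedRow b i) (closedRow-onto b i) (begin
      closedRow b i j   ≡⟨ closedRow-off b i j j≢i ⟩
      c (b , j)         ≡⟨ cbj≡cbj' ⟩
      c (b , j')        ≡⟨ closedRow-off b i j' j'≢i ⟨
      closedRow b i j'  ∎)
    where open ≡-Reasoning

  -- If row opp b shows every colour, row b copies it column by column: the
  -- column of row opp b sharing the colour of (b , i) cannot be adjacent to it.
  rows-agree : ∀ b → Onto (λ j → c (opp b , j)) → ∀ i → c (b , i) ≡ c (opp b , i)
  rows-agree b opp-row-onto i with opp-row-onto (c (b , i))
  ... | j , c[opp-b,j]≡c[b,i] with j ≟ i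
  ...   | yes refl = sym c[opp-b,j]≡c[b,i]
  ...   | no  j≢i  = ⊥-elim (independent (b , i) (opp b , j)
                              (opp-≢ b , ≢-sym j≢i) (sym c[opp-b,j]≡c[b,i]))

fall-coloring-relabels-columns :
  ∀ m (c : V (F (suc (suc (suc m)))) → Fin (suc (suc (suc m)))) →
  IsFallColoring (F (suc (suc (suc m)))) (suc (suc (suc m))) c →
  Σ (Fin (suc (suc (suc m))) ↔ Fin (suc (suc (suc m)))) λ π → ∀ v → c v ≡ Inverse.to π (proj₂ v)
fall-coloring-relabels-columns m c fall = relabel , c≡relabel∘column
  where
  open FallColoring c fall

  -- Any two columns j ≢ j' avoid some column i, so each row is injective.
  row-injective : ∀ b → Injective _≡_ _≡_ (λ j → c (b , j))
  row-injective b {j} {j'} with avoid-two j j'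
  ... | i , i≢j , i≢j' = row-injective-off b i (≢-sym i≢j) (≢-sym i≢j')

  relabel : Fin (suc (suc (suc m))) ↔ Fin (suc (suc (suc m)))
  relabel = injective⇒permutation (λ j → c (fz , j)) (row-injective fz)

  c≡relabel∘column : ∀ v → c v ≡ Inverse.to relabel (proj₂ v)
  c≡relabel∘column (fz    , i) = refl
  c≡relabel∘column (fs fz , i) =
    rows-agree (fs fz) (injective⇒onto _ (row-injective fz)) i

proposition1 : (k : ℕ) → 3 ≤ k → Bipartite (F k) × UniqueFallColoring (F k) k
proposition1 (suc (suc (suc m))) (s≤s (s≤s (s≤s _))) =
  F-bipartite _ ,
  (proj₂ , columns-isFall _ , fall-coloring-relabels-columns m)
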